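{- For $n\ge1$ there is a bijection mapping each permutation $\sigma$ of $[n]$ with $k$ exterior peaks to an increasing tree $T$ on $\{0,1,\dots,n\}$ with $j$ nonroot vertices of even degree such that $k=\lfloor (j+1)/2\rfloor$.
   Context: An exterior peak of a permutation $\sigma=\sigma_1\cdots\sigma_n$ of $[n]$ is an index $1\le i\le n$ with $\sigma_{i-1}<\sigma_i>\sigma_{i+1}$, where $\sigma_0=\sigma_{n+1}=0$. An increasing tree on $\{0,1,\dots,n\}$ is a rooted tree with vertex set $\{0,\dots,n\}$, root $0$, in which every child is larger than its parent (children unordered); the degree of a vertex is its number of children. -}

module Defs where

open import Data.Nat using (ℕ; zero; suc; _+_; _<ᵇ_; _≡ᵇ_; _%_)
open import Data.Bool using (Bool; true; false; _∧_; if_then_else_)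
open import Data.Fin using (Fin; toℕ)
open import Data.List using (List; []; _∷_; _++_; map; applyUpTo)
open import Data.Fin.Permutation using (Permutation′; _⟨$⟩ʳ_)
open import Data.List using () renaming (allFin to listAllFin)

-- The one-line word σ₁ ⋯ σₙ of a permutation of [n] = {1,…,n}
-- (Fin n = {0,…,n-1} is shifted by one).
word : ∀ {n} → Permutation′ n → List ℕ
word {n} σ = map (λ i → suc (toℕ (σ ⟨$⟩ʳ i))) (listAllFin n)

countPeaks : List ℕ → ℕ
countPeaks (a ∷ b ∷ c ∷ rest) =
  (if (a <ᵇ b) ∧ (c <ᵇ b) then 1 else 0) + countPeaks (b ∷ c ∷ rest)
countPeaks _ = 0

extPeaks : ∀ {n} → Permutation′ n → ℕ
extPeaks σ = countPeaks (0 ∷ word σ ++ (0 ∷ []))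

-- Increasing trees on {0,1,…,n}, rooted at 0.
-- An increasing tree on {0,…,n} is determined by the parent of each
-- nonroot vertex v ∈ {1,…,n}, which is any vertex in {0,…,v-1}.
-- `t ▷ p` : the tree on {0,…,n+1} obtained from t (on {0,…,n}) by
-- attaching the new vertex n+1 as a child of p ∈ {0,…,n}.
-- Every increasing tree arises in exactly one way.

data IncTree : ℕ → Set where
  root : IncTree 0
  _▷_  : ∀ {n} → IncTree n → Fin (suc n) → IncTree (suc n)

deg : ∀ {n} → IncTree n → ℕ → ℕ
deg root          v = 0
deg (t ▷ p) v = deg t v + (if toℕ p ≡ᵇ v then 1 else 0)

count : (ℕ → Bool) → List ℕ → ℕ
count P []       = 0
count P (x ∷ xs) = (if P x then 1 else 0) + count P xs

evenNonroot : ∀ {n} → IncTree n → ℕ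
evenNonroot {n} t = count (λ v → deg t v % 2 ≡ᵇ 0) (applyUpTo suc n)

{-# OPTIONS --safe #-}
-- Build both objects by adding the values 1, …, n one at a time.  Inserting
-- the new maximum into one of the n + 1 gaps of 0 σ 0 keeps the number k of
-- exterior peaks if the gap is next to a peak (2k such gaps, since peaks are
-- never adjacent) and raises k by one otherwise.  Hanging the new vertex as a
-- leaf from one of the n + 1 vertices of a tree with j even nonroot vertices
-- keeps ⌈j/2⌉ = ⌊(j+1)/2⌋ if the parent is a nonroot vertex of even degree, or
-- the root when j is odd (2⌈j/2⌉ choices in all), and raises it by one
-- otherwise.  So as long as k = ⌈j/2⌉ the neutral choices on the two sides
-- are equinumerous, and matching them at every step gives the bijection.
module Submission where

open import Defs
open import Data.Nat using (ℕ; zero; suc; _+_; _*_; _%_; _/_; ⌊_/2⌋; ⌈_/2⌉; _<_; _≤_; _<ᵇ_; _≡ᵇ_; s≤s; z≤n; z<s; s<s)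
open import Data.Nat.DivMod using (m/n≡1+[m∸n]/n)
open import Data.Nat.Properties using (+-assoc; +-comm; +-suc; *-suc; ≡ᵇ⇒≡; <⇒≢; <⇒≤; <-≤-trans; +-identityʳ; +-cancelʳ-≡; ≤-reflexive; suc-injective; n≮n; <⇒≯; ≤-refl; m≤n⇒m≤1+n; <ᵇ-reflects-<)
open import Data.Nat.Tactic.RingSolver using (solve-∀)
open import Data.Unit using (tt)
open import Data.Bool using (Bool; true; false; if_then_else_; not; _∧_; _∨_)
open import Data.Bool.Properties using (∧-zeroʳ; not-involutive)
open import Data.List using (List; []; _∷_; _++_; length; tabulate; applyUpTo; allFin)
open import Data.List.Properties using (length-++; length-tabulate; map-tabulate; map-cong; tabulate-cong)
open import Data.List.Relation.Unary.All.Properties using (++⁺; map⁺; tabulate⁺)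
open import Data.List.Relation.Unary.All using (All; []; _∷_)
open import Data.Fin using (Fin; zero; suc; toℕ; fromℕ; inject₁; punchIn; punchOut)
open import Data.Fin.Properties using (toℕ-inject₁; toℕ-fromℕ; toℕ<n; toℕ≤pred[n]; _≟_; punchOut-cong)
open import Data.Fin.Permutation
  using (Permutation′; _≈_; _⟨$⟩ʳ_; _⟨$⟩ˡ_; id; flip; _∘ₚ_; insert; remove; inverseˡ; inverseʳ;
         insert-punchIn; insert-remove; remove-insert)
open import Data.Product using (Σ; _×_; ∃; _,_)
open import Function using (_∘_)
open import Relation.Nullary using (¬_; contradiction; yes; no)
open import Relation.Nullary.Reflects using (ofʸ; ofⁿ)
open import Relation.Binary.PropositionalEquality using (_≡_; _≢_; refl; sym; trans; cong; cong₂; subst; module ≡-Reasoning)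
open ≡-Reasoning

𝟙 : Bool → ℕ
𝟙 b = if b then 1 else 0

∑< : ℕ → (ℕ → ℕ) → ℕ
∑< zero    f = 0
∑< (suc N) f = f 0 + ∑< N (f ∘ suc)

syntax ∑< N (λ v → e) = ∑[ v < N ] e

+𝟙-cancel : ∀ {x y} b → x + 𝟙 b ≡ y + 1 → x ≡ y + 𝟙 (not b)
+𝟙-cancel {x} {y} true  eq = trans (+-cancelʳ-≡ 1 x y eq) (sym (+-identityʳ y))
+𝟙-cancel {x}     false eq = trans (sym (+-identityʳ x)) eq

𝟙-∨ : ∀ p q → p ∧ q ≡ false → 𝟙 (p ∨ q) ≡ 𝟙 p + 𝟙 q
𝟙-∨ true  false _ = refl
𝟙-∨ false q     _ = refl

∑-cong : ∀ N {f g : ℕ → ℕ} → (∀ v → f v ≡ g v) → ∑< N f ≡ ∑< N g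
∑-cong zero    f≗g = refl
∑-cong (suc N) f≗g = cong₂ _+_ (f≗g 0) (∑-cong N (f≗g ∘ suc))

∑-zero : ∀ N (f : ℕ → ℕ) → (∀ v → f v ≡ 0) → ∑< N f ≡ 0
∑-zero zero    f f≗0 = refl
∑-zero (suc N) f f≗0 = cong₂ _+_ (f≗0 0) (∑-zero N (f ∘ suc) (f≗0 ∘ suc))

∑-distrib-+ : ∀ N (f g : ℕ → ℕ) → ∑[ v < N ] (f v + g v) ≡ ∑< N f + ∑< N g
∑-distrib-+ zero    f g = refl
∑-distrib-+ (suc N) f g = begin
  f 0 + g 0 + ∑[ v < N ] (f (suc v) + g (suc v))   ≡⟨ cong (f 0 + g 0 +_) (∑-distrib-+ N (f ∘ suc) (g ∘ suc)) ⟩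
  f 0 + g 0 + (∑< N (f ∘ suc) + ∑< N (g ∘ suc))  ≡⟨ interchange (f 0) (g 0) _ _ ⟩
  f 0 + ∑< N (f ∘ suc) + (g 0 + ∑< N (g ∘ suc))  ∎
  where
  interchange : ∀ a b c d → a + b + (c + d) ≡ a + c + (b + d)
  interchange = solve-∀

∑-init-last : ∀ N (f : ℕ → ℕ) → ∑< (suc N) f ≡ ∑< N f + f N
∑-init-last zero    f = +-comm (f 0) 0
∑-init-last (suc N) f = begin
  f 0 + ∑< (suc N) (f ∘ suc)    ≡⟨ cong (f 0 +_) (∑-init-last N (f ∘ suc)) ⟩
  f 0 + (∑< N (f ∘ suc) + f (suc N)) ≡⟨ +-assoc (f 0) _ _ ⟨
  ∑< (suc N) f + f (suc N)      ∎

∑-update : ∀ N (f g : ℕ → ℕ) q → q < N → (∀ v → v ≢ q → f v ≡ g v) →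
           ∑< N f + g q ≡ ∑< N g + f q
∑-update (suc N) f g zero    _         f≗g = begin
  f 0 + ∑< N (f ∘ suc) + g 0 ≡⟨ cong (λ s → f 0 + s + g 0) (∑-cong N (λ v → f≗g (suc v) λ ())) ⟩
  f 0 + ∑< N (g ∘ suc) + g 0 ≡⟨ swap (f 0) _ (g 0) ⟩
  g 0 + ∑< N (g ∘ suc) + f 0 ∎
  where
  swap : ∀ a s b → a + s + b ≡ b + s + a
  swap = solve-∀
∑-update (suc N) f g (suc q) (s≤s q<N) f≗g = begin
  f 0 + ∑< N (f ∘ suc) + g (suc q)   ≡⟨ +-assoc (f 0) _ _ ⟩
  f 0 + (∑< N (f ∘ suc) + g (suc q)) ≡⟨ cong₂ _+_ (f≗g 0 λ ()) (∑-update N (f ∘ suc) (g ∘ suc) q q<N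
                                          λ v v≢q → f≗g (suc v) (v≢q ∘ suc-injective)) ⟩
  g 0 + (∑< N (g ∘ suc) + f (suc q)) ≡⟨ +-assoc (g 0) _ _ ⟨
  g 0 + ∑< N (g ∘ suc) + f (suc q)   ∎

<⇒<ᵇ≡true : ∀ {m n} → m < n → (m <ᵇ n) ≡ true
<⇒<ᵇ≡true {m} {n} m<n with m <ᵇ n | <ᵇ-reflects-< m n
... | true  | _       = refl
... | false | ofⁿ m≮n = contradiction m<n m≮n

≮⇒<ᵇ≡false : ∀ {m n} → ¬ m < n → (m <ᵇ n) ≡ false
≮⇒<ᵇ≡false {m} {n} m≮n with m <ᵇ n | <ᵇ-reflects-< m n
... | false | _       = refl
... | true  | ofʸ m<n = contradiction m<n m≮n

≡ᵇ-refl : ∀ m → (m ≡ᵇ m) ≡ true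
≡ᵇ-refl zero    = refl
≡ᵇ-refl (suc m) = ≡ᵇ-refl m

≢⇒≡ᵇ≡false : ∀ {m n} → m ≢ n → (m ≡ᵇ n) ≡ false
≢⇒≡ᵇ≡false {m} {n} m≢n with m ≡ᵇ n | ≡ᵇ⇒≡ m n
... | false | _       = refl
... | true  | ≡ᵇ⇒m≡n = contradiction (≡ᵇ⇒m≡n tt) m≢n

-- Matching two predicates that hold equally often

countFin : ∀ m → (ℕ → Bool) → Fin (suc m)
countFin zero    P = zero
countFin (suc m) P = if P 0 then suc (countFin m (P ∘ suc)) else inject₁ (countFin m (P ∘ suc))

toℕ-countFin : ∀ m (P : ℕ → Bool) → toℕ (countFin m P) ≡ ∑[ v < m ] 𝟙 (P v)
toℕ-countFin zero    P = refl
toℕ-countFin (suc m) P with P 0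
... | true  = cong suc (toℕ-countFin m (P ∘ suc))
... | false = trans (toℕ-inject₁ _) (toℕ-countFin m (P ∘ suc))

punchIn-<ᵇ : ∀ {n} (j : Fin (suc n)) (k : Fin n) → (toℕ (punchIn j k) <ᵇ toℕ j) ≡ (toℕ k <ᵇ toℕ j)
punchIn-<ᵇ zero    k       = refl
punchIn-<ᵇ (suc j) zero    = refl
punchIn-<ᵇ (suc j) (suc k) = punchIn-<ᵇ j k

-- The stable partition of [0, m) by P: the positions satisfying P go, in
-- order, onto [0, #P), the others onto [#P, m).
rank : ∀ m → (ℕ → Bool) → Permutation′ m
rank zero    P = id
rank (suc m) P = insert zero (if P 0 then zero else countFin m (P ∘ suc)) (rank m (P ∘ suc))

rank-spec : ∀ m (P : ℕ → Bool) (x : Fin m) → P (toℕ x) ≡ (toℕ (rank m P ⟨$⟩ʳ x) <ᵇ ∑[ v < m ] 𝟙 (P v))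
rank-spec (suc m) P zero with P 0
... | true  = refl
... | false = sym (begin
  toℕ (countFin m (P ∘ suc)) <ᵇ #P ≡⟨ cong (_<ᵇ #P) (toℕ-countFin m (P ∘ suc)) ⟩
  #P <ᵇ #P                         ≡⟨ ≮⇒<ᵇ≡false (n≮n #P) ⟩
  false                            ∎)
  where #P = ∑[ v < m ] 𝟙 (P (suc v))
rank-spec (suc m) P (suc x) rewrite insert-punchIn zero (if P 0 then zero else countFin m (P ∘ suc)) (rank m (P ∘ suc)) x
  with P 0
... | true  = rank-spec m (P ∘ suc) x
... | false = begin
  P (suc (toℕ x))                               ≡⟨ rank-spec m (P ∘ suc) x ⟩
  toℕ r <ᵇ #P                                   ≡⟨ cong (toℕ r <ᵇ_) (toℕ-countFin m (P ∘ suc)) ⟨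
  toℕ r <ᵇ toℕ c                                ≡⟨ punchIn-<ᵇ c r ⟨
  toℕ (punchIn c r) <ᵇ toℕ c                    ≡⟨ cong (toℕ (punchIn c r) <ᵇ_) (toℕ-countFin m (P ∘ suc)) ⟩
  toℕ (punchIn c r) <ᵇ #P                       ∎
  where
  r  = rank m (P ∘ suc) ⟨$⟩ʳ x
  c  = countFin m (P ∘ suc)
  #P = ∑[ v < m ] 𝟙 (P (suc v))

matching : ∀ m → (P Q : ℕ → Bool) → Permutation′ m
matching m P Q = rank m P ∘ₚ flip (rank m Q)

matching-spec : ∀ m (P Q : ℕ → Bool) → ∑[ v < m ] 𝟙 (P v) ≡ ∑[ v < m ] 𝟙 (Q v) →
                ∀ x → P (toℕ x) ≡ Q (toℕ (matching m P Q ⟨$⟩ʳ x))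
matching-spec m P Q #P≡#Q x = begin
  P (toℕ x)                                                     ≡⟨ rank-spec m P x ⟩
  toℕ (rank m P ⟨$⟩ʳ x) <ᵇ ∑[ v < m ] 𝟙 (P v)                   ≡⟨ cong₂ (λ y k → toℕ y <ᵇ k) (sym (inverseʳ (rank m Q))) #P≡#Q ⟩
  toℕ (rank m Q ⟨$⟩ʳ (matching m P Q ⟨$⟩ʳ x)) <ᵇ ∑[ v < m ] 𝟙 (Q v) ≡⟨ rank-spec m Q _ ⟨
  Q (toℕ (matching m P Q ⟨$⟩ʳ x))                               ∎

-- Permutations as insertion codes

insert-at : ∀ {n} (i j : Fin (suc n)) (π : Permutation′ n) → insert i j π ⟨$⟩ʳ i ≡ j
insert-at i j π with i ≟ i
... | yes _   = refl
... | no  i≢i = contradiction refl i≢i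

insert-cong : ∀ {n} (i j : Fin (suc n)) {π ρ : Permutation′ n} → π ≈ ρ → insert i j π ≈ insert i j ρ
insert-cong i j π≈ρ k with i ≟ k
... | yes _   = refl
... | no  i≢k = cong (punchIn j) (π≈ρ (punchOut i≢k))

punchOut-cong₂ : ∀ {n} {i i′ j j′ : Fin (suc n)} (i≢j : i ≢ j) (i′≢j′ : i′ ≢ j′) →
                 i ≡ i′ → j ≡ j′ → punchOut i≢j ≡ punchOut i′≢j′
punchOut-cong₂ {i = i} _ _ refl refl = punchOut-cong i refl

remove-cong : ∀ {n} (i : Fin (suc n)) {σ τ : Permutation′ (suc n)} → σ ≈ τ → remove i σ ≈ remove i τ
remove-cong i σ≈τ k = punchOut-cong₂ _ _ (σ≈τ i) (σ≈τ (punchIn i k))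

⟨$⟩ˡ-cong : ∀ {n} {σ τ : Permutation′ n} → σ ≈ τ → ∀ x → σ ⟨$⟩ˡ x ≡ τ ⟨$⟩ˡ x
⟨$⟩ˡ-cong {σ = σ} {τ} σ≈τ x = begin
  σ ⟨$⟩ˡ x                    ≡⟨ cong (σ ⟨$⟩ˡ_) (inverseʳ τ) ⟨
  σ ⟨$⟩ˡ (τ ⟨$⟩ʳ (τ ⟨$⟩ˡ x))  ≡⟨ cong (σ ⟨$⟩ˡ_) (σ≈τ _) ⟨
  σ ⟨$⟩ˡ (σ ⟨$⟩ʳ (τ ⟨$⟩ˡ x))  ≡⟨ inverseˡ σ ⟩
  τ ⟨$⟩ˡ x                    ∎

insertMax : ∀ {n} → Fin (suc n) → Permutation′ n → Permutation′ (suc n)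
insertMax {n} i π = insert i (fromℕ n) π

-- An IncTree n is a sequence of choices in Fin 1, …, Fin n, and so also
-- codes a permutation: the k-th choice is where the value k is inserted.
perm : ∀ {n} → IncTree n → Permutation′ n
perm root    = id
perm (c ▷ i) = insertMax i (perm c)

code : ∀ {n} → Permutation′ n → IncTree n
code {zero}  σ = root
code {suc n} σ = code (remove (σ ⟨$⟩ˡ fromℕ n) σ) ▷ (σ ⟨$⟩ˡ fromℕ n)

code-suc : ∀ {n} (σ : Permutation′ (suc n)) i → σ ⟨$⟩ˡ fromℕ n ≡ i → code σ ≡ code (remove i σ) ▷ i
code-suc σ i refl = refl

code-cong : ∀ {n} {σ τ : Permutation′ n} → σ ≈ τ → code σ ≡ code τ
code-cong {zero}          σ≈τ = refl
code-cong {suc n} {σ} {τ} σ≈τ = begin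
  code σ                ≡⟨ code-suc σ i (⟨$⟩ˡ-cong {σ = σ} {τ} σ≈τ (fromℕ n)) ⟩
  code (remove i σ) ▷ i ≡⟨ cong (_▷ i) (code-cong (remove-cong i {σ} {τ} σ≈τ)) ⟩
  code (remove i τ) ▷ i ∎
  where i = τ ⟨$⟩ˡ fromℕ n

perm-code : ∀ {n} (σ : Permutation′ n) → perm (code σ) ≈ σ
perm-code {zero}  σ ()
perm-code {suc n} σ k = begin
  insert i (fromℕ n) (perm (code (remove i σ))) ⟨$⟩ʳ k ≡⟨ insert-cong i (fromℕ n) (perm-code (remove i σ)) k ⟩
  insert i (fromℕ n) (remove i σ) ⟨$⟩ʳ k               ≡⟨ cong (λ j → insert i j (remove i σ) ⟨$⟩ʳ k) (inverseʳ σ) ⟨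
  insert i (σ ⟨$⟩ʳ i) (remove i σ) ⟨$⟩ʳ k              ≡⟨ insert-remove i σ k ⟩
  σ ⟨$⟩ʳ k                                              ∎
  where i = σ ⟨$⟩ˡ fromℕ n

code-perm : ∀ {n} (c : IncTree n) → code (perm c) ≡ c
code-perm root          = refl
code-perm {suc n} (c ▷ i) = begin
  code (insertMax i (perm c))                    ≡⟨ code-suc (insertMax i (perm c)) i max↦i ⟩
  code (remove i (insertMax i (perm c))) ▷ i     ≡⟨ cong (_▷ i) (code-cong (remove-insert i _ (perm c))) ⟩
  code (perm c) ▷ i                              ≡⟨ cong (_▷ i) (code-perm c) ⟩
  c ▷ i                                          ∎
  where
  max↦i : insertMax i (perm c) ⟨$⟩ˡ fromℕ n ≡ i
  max↦i = trans (cong (insertMax i (perm c) ⟨$⟩ˡ_) (sym (insert-at i (fromℕ n) (perm c)))) (inverseˡ (insertMax i (perm c)))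

code-injective : ∀ {n} {σ τ : Permutation′ n} → code σ ≡ code τ → σ ≈ τ
code-injective {σ = σ} {τ} eq k = begin
  σ ⟨$⟩ʳ k             ≡⟨ perm-code σ k ⟨
  perm (code σ) ⟨$⟩ʳ k ≡⟨ cong (λ c → perm c ⟨$⟩ʳ k) eq ⟩
  perm (code τ) ⟨$⟩ʳ k ≡⟨ perm-code τ k ⟩
  τ ⟨$⟩ʳ k             ∎

-- Peaks of a list and the insertion of a new maximum

peak : ℕ → ℕ → ℕ → Bool
peak a b c = (a <ᵇ b) ∧ (c <ᵇ b)

peak-∧-peak : ∀ a b c d → peak a b c ∧ peak b c d ≡ false
peak-∧-peak a b c d with a <ᵇ b | c <ᵇ b | <ᵇ-reflects-< c b | b <ᵇ c | <ᵇ-reflects-< b c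
... | false | _     | _       | _     | _       = refl
... | true  | false | _       | _     | _       = refl
... | true  | true  | _       | false | _       = refl
... | true  | true  | ofʸ c<b | true  | ofʸ b<c = contradiction b<c (<⇒≯ c<b)

-- peakAt g z: the entry of index g of z is a peak (the two end entries never are).
peakAt : ℕ → List ℕ → Bool
peakAt (suc zero)    (a ∷ b ∷ c ∷ _) = peak a b c
peakAt (suc (suc g)) (_ ∷ z)         = peakAt (suc g) z
peakAt _             _               = false

-- touchesPeak g z: the gap between the entries of index g and g + 1 is next to a peak.
touchesPeak : ℕ → List ℕ → Bool
touchesPeak g z = peakAt g z ∨ peakAt (suc g) z

peakAt-∧-peakAt-suc : ∀ g z → peakAt g z ∧ peakAt (suc g) z ≡ false
peakAt-∧-peakAt-suc zero          z                   = refl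
peakAt-∧-peakAt-suc (suc zero)    (a ∷ b ∷ c ∷ d ∷ _) = peak-∧-peak a b c d
peakAt-∧-peakAt-suc (suc zero)    (a ∷ b ∷ c ∷ [])    = ∧-zeroʳ (peak a b c)
peakAt-∧-peakAt-suc (suc zero)    (a ∷ b ∷ [])        = refl
peakAt-∧-peakAt-suc (suc zero)    (a ∷ [])            = refl
peakAt-∧-peakAt-suc (suc zero)    []                  = refl
peakAt-∧-peakAt-suc (suc (suc g)) (_ ∷ z)             = peakAt-∧-peakAt-suc (suc g) z
peakAt-∧-peakAt-suc (suc (suc g)) []                  = refl

peakAt-short : ∀ g z → length z ≤ 2 → peakAt g z ≡ false
peakAt-short zero          z                   _                = refl
peakAt-short (suc zero)    []                  _                = refl
peakAt-short (suc zero)    (a ∷ [])            _                = refl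
peakAt-short (suc zero)    (a ∷ b ∷ [])        _                = refl
peakAt-short (suc zero)    (a ∷ b ∷ c ∷ _)     (s≤s (s≤s ()))
peakAt-short (suc (suc g)) []                  _                = refl
peakAt-short (suc (suc g)) (_ ∷ z)             (s≤s len)        = peakAt-short (suc g) z (m≤n⇒m≤1+n len)

∑-peakAt : ∀ N z → length z ≤ 2 + N → ∑[ g < N ] 𝟙 (peakAt (suc g) z) ≡ countPeaks z
∑-peakAt (suc N) (a ∷ b ∷ c ∷ r) (s≤s len)      = cong (𝟙 (peak a b c) +_) (∑-peakAt N (b ∷ c ∷ r) len)
∑-peakAt zero    (a ∷ b ∷ c ∷ r) (s≤s (s≤s ()))
∑-peakAt N       []              _              = ∑-zero N _ λ g → cong 𝟙 (peakAt-short (suc g) [] z≤n)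
∑-peakAt N       (a ∷ [])        _              = ∑-zero N _ λ g → cong 𝟙 (peakAt-short (suc g) (a ∷ []) (s≤s z≤n))
∑-peakAt N       (a ∷ b ∷ [])    _              = ∑-zero N _ λ g → cong 𝟙 (peakAt-short (suc g) (a ∷ b ∷ []) ≤-refl)

𝟙-touchesPeak : ∀ g z → 𝟙 (touchesPeak g z) ≡ 𝟙 (peakAt g z) + 𝟙 (peakAt (suc g) z)
𝟙-touchesPeak g z = 𝟙-∨ (peakAt g z) (peakAt (suc g) z) (peakAt-∧-peakAt-suc g z)

-- Every peak is next to exactly two gaps, and no gap is next to two peaks.
∑-touchesPeak : ∀ N z → length z ≤ 2 + N → ∑[ g < suc N ] 𝟙 (touchesPeak g z) ≡ 2 * countPeaks z
∑-touchesPeak N z len = begin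
  ∑[ g < suc N ] 𝟙 (touchesPeak g z)                                    ≡⟨ ∑-cong (suc N) (λ g → 𝟙-touchesPeak g z) ⟩
  ∑[ g < suc N ] (𝟙 (peakAt g z) + 𝟙 (peakAt (suc g) z))               ≡⟨ ∑-distrib-+ (suc N) (λ g → 𝟙 (peakAt g z)) (λ g → 𝟙 (peakAt (suc g) z)) ⟩
  ∑[ g < N ] 𝟙 (peakAt (suc g) z) + ∑[ g < suc N ] 𝟙 (peakAt (suc g) z) ≡⟨ cong₂ _+_ (∑-peakAt N z len) (∑-peakAt (suc N) z (m≤n⇒m≤1+n len)) ⟩
  countPeaks z + countPeaks z                                           ≡⟨ cong (countPeaks z +_) (+-identityʳ _) ⟨
  2 * countPeaks z                                                      ∎

insertAt : ℕ → ℕ → List ℕ → List ℕ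
insertAt zero    x z       = x ∷ z
insertAt (suc g) x []      = x ∷ []
insertAt (suc g) x (a ∷ z) = a ∷ insertAt g x z

countPeaks-∷-descent : ∀ {a b} r → b < a → countPeaks (a ∷ b ∷ r) ≡ countPeaks (b ∷ r)
countPeaks-∷-descent []      b<a = refl
countPeaks-∷-descent (c ∷ r) b<a rewrite ≮⇒<ᵇ≡false (<⇒≯ b<a) = refl

-- Inserting a new maximum into a gap creates one peak and destroys those next to the gap.
countPeaks-insertAt : ∀ {m} g z → All (_< m) z → suc g < length z →
  countPeaks (insertAt (suc g) m z) + (𝟙 (peakAt g z) + 𝟙 (peakAt (suc g) z)) ≡ countPeaks z + 1
countPeaks-insertAt zero (a ∷ b ∷ r) (a<m ∷ b<m ∷ _) _
  rewrite <⇒<ᵇ≡true a<m | <⇒<ᵇ≡true b<m | countPeaks-∷-descent r b<m with r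
... | []    = refl
... | c ∷ r′ = rearrange (countPeaks (b ∷ c ∷ r′)) (𝟙 (peak a b c))
  where
  rearrange : ∀ x y → suc x + y ≡ y + x + 1
  rearrange = solve-∀
countPeaks-insertAt (suc zero) (a ∷ b ∷ c ∷ r) (_ ∷ b<m ∷ c<m ∷ _) _
  rewrite ≮⇒<ᵇ≡false (<⇒≯ b<m) | ∧-zeroʳ (a <ᵇ b) | <⇒<ᵇ≡true b<m | <⇒<ᵇ≡true c<m | countPeaks-∷-descent r c<m
  with r
... | []    = +-comm 1 (𝟙 (peak a b c) + 0)
... | d ∷ r′ = rearrange (countPeaks (c ∷ d ∷ r′)) (𝟙 (peak a b c)) (𝟙 (peak b c d))
  where
  rearrange : ∀ x y y′ → suc x + (y + y′) ≡ y + (y′ + x) + 1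
  rearrange = solve-∀
countPeaks-insertAt (suc (suc g)) (a ∷ b ∷ c ∷ z) (_ ∷ all<m) (s≤s len) = begin
  𝟙 (peak a b c) + countPeaks (b ∷ c ∷ insertAt g _ z) + adjacent ≡⟨ +-assoc (𝟙 (peak a b c)) _ _ ⟩
  𝟙 (peak a b c) + (countPeaks (b ∷ c ∷ insertAt g _ z) + adjacent) ≡⟨ cong (𝟙 (peak a b c) +_) (countPeaks-insertAt (suc g) (b ∷ c ∷ z) all<m len) ⟩
  𝟙 (peak a b c) + (countPeaks (b ∷ c ∷ z) + 1)                     ≡⟨ +-assoc (𝟙 (peak a b c)) _ _ ⟨
  countPeaks (a ∷ b ∷ c ∷ z) + 1                                    ∎
  where adjacent = 𝟙 (peakAt (suc g) (b ∷ c ∷ z)) + 𝟙 (peakAt (suc (suc g)) (b ∷ c ∷ z))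
countPeaks-insertAt zero       (a ∷ [])     _ (s≤s ())
countPeaks-insertAt (suc zero) (a ∷ [])     _ (s≤s ())
countPeaks-insertAt (suc zero) (a ∷ b ∷ []) _ (s≤s (s≤s ()))
countPeaks-insertAt (suc (suc g)) (a ∷ []) _ (s≤s ())
countPeaks-insertAt (suc (suc g)) (a ∷ b ∷ []) _ (s≤s (s≤s ()))

insertAt-++ : ∀ g x (w ys : List ℕ) → g ≤ length w → insertAt g x (w ++ ys) ≡ insertAt g x w ++ ys
insertAt-++ zero    x w       ys _         = refl
insertAt-++ (suc g) x (a ∷ w) ys (s≤s g≤) = cong (a ∷_) (insertAt-++ g x w ys g≤)

tabulate-punchIn : ∀ {n} (f : Fin (suc n) → ℕ) i → tabulate f ≡ insertAt (toℕ i) (f i) (tabulate (f ∘ punchIn i))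
tabulate-punchIn         f zero    = refl
tabulate-punchIn {suc n} f (suc i) = cong (f zero ∷_) (tabulate-punchIn (f ∘ suc) i)

toℕ-punchIn-fromℕ : ∀ {n} (k : Fin n) → toℕ (punchIn (fromℕ n) k) ≡ toℕ k
toℕ-punchIn-fromℕ zero    = refl
toℕ-punchIn-fromℕ (suc k) = cong suc (toℕ-punchIn-fromℕ k)

word-tabulate : ∀ {n} (σ : Permutation′ n) → word σ ≡ tabulate (λ i → suc (toℕ (σ ⟨$⟩ʳ i)))
word-tabulate σ = map-tabulate (λ i → i) (λ i → suc (toℕ (σ ⟨$⟩ʳ i)))

length-word : ∀ {n} (σ : Permutation′ n) → length (word σ) ≡ n
length-word σ = trans (cong length (word-tabulate σ)) (length-tabulate _)

word-insertMax : ∀ {n} i (π : Permutation′ n) → word (insertMax i π) ≡ insertAt (toℕ i) (suc n) (word π)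
word-insertMax {n} i π = begin
  word (insertMax i π)                                                     ≡⟨ word-tabulate (insertMax i π) ⟩
  tabulate f                                                               ≡⟨ tabulate-punchIn f i ⟩
  insertAt (toℕ i) (f i) (tabulate (f ∘ punchIn i))                        ≡⟨ cong₂ (insertAt (toℕ i)) f[i]≡1+n
                                                                                (tabulate-cong λ k → cong suc f[punchIn]) ⟩
  insertAt (toℕ i) (suc n) (tabulate (λ k → suc (toℕ (π ⟨$⟩ʳ k))))        ≡⟨ cong (insertAt (toℕ i) (suc n)) (word-tabulate π) ⟨
  insertAt (toℕ i) (suc n) (word π)                                        ∎
  where
  f = λ k → suc (toℕ (insertMax i π ⟨$⟩ʳ k))
  f[i]≡1+n : f i ≡ suc n
  f[i]≡1+n = cong suc (trans (cong toℕ (insert-at i (fromℕ n) π)) (toℕ-fromℕ n))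
  f[punchIn] : ∀ {k} → toℕ (insertMax i π ⟨$⟩ʳ punchIn i k) ≡ toℕ (π ⟨$⟩ʳ k)
  f[punchIn] {k} = trans (cong toℕ (insert-punchIn i (fromℕ n) π k)) (toℕ-punchIn-fromℕ _)

padded : List ℕ → List ℕ
padded w = 0 ∷ w ++ 0 ∷ []

length-padded : ∀ w → length (padded w) ≡ 2 + length w
length-padded w = cong suc (trans (length-++ w) (+-comm (length w) 1))

padded-word<1+n : ∀ {n} (π : Permutation′ n) → All (_< suc n) (padded (word π))
padded-word<1+n π = z<s ∷ ++⁺ (map⁺ (tabulate⁺ λ k → s<s (toℕ<n (π ⟨$⟩ʳ k)))) (z<s ∷ [])

nearPeak : ∀ {n} → Permutation′ n → ℕ → Bool
nearPeak π g = touchesPeak g (padded (word π))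

extPeaks-insertMax : ∀ {n} i (π : Permutation′ n) → extPeaks (insertMax i π) ≡ extPeaks π + 𝟙 (not (nearPeak π (toℕ i)))
extPeaks-insertMax {n} i π = +𝟙-cancel (nearPeak π (toℕ i)) (begin
  extPeaks (insertMax i π) + 𝟙 (nearPeak π g)                                 ≡⟨ cong₂ _+_ padded-insert (𝟙-touchesPeak g z) ⟩
  countPeaks (insertAt (suc g) (suc n) z) + (𝟙 (peakAt g z) + 𝟙 (peakAt (suc g) z)) ≡⟨ countPeaks-insertAt g z (padded-word<1+n π) g<len ⟩
  extPeaks π + 1                                                              ∎)
  where
  g = toℕ i
  z = padded (word π)
  g≤n : g ≤ length (word π)
  g≤n = subst (g ≤_) (sym (length-word π)) (toℕ≤pred[n] i)
  g<len : suc g < length z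
  g<len = subst (suc g <_) (sym (length-padded (word π))) (s≤s (s≤s g≤n))
  padded-insert : extPeaks (insertMax i π) ≡ countPeaks (insertAt (suc g) (suc n) z)
  padded-insert = cong (λ w → countPeaks (0 ∷ w)) (trans (cong (_++ 0 ∷ []) (word-insertMax i π))
                                                         (sym (insertAt-++ g (suc n) (word π) (0 ∷ []) g≤n)))

∑-nearPeak : ∀ {n} (π : Permutation′ n) → ∑[ g < suc n ] 𝟙 (nearPeak π g) ≡ 2 * extPeaks π
∑-nearPeak {n} π = ∑-touchesPeak n (padded (word π))
  (≤-reflexive (trans (length-padded (word π)) (cong (2 +_) (length-word π))))

extPeaks-cong : ∀ {n} {σ τ : Permutation′ n} → σ ≈ τ → extPeaks σ ≡ extPeaks τ
extPeaks-cong {n} σ≈τ = cong (countPeaks ∘ padded) (map-cong (λ i → cong (suc ∘ toℕ) (σ≈τ i)) (allFin n))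

-- Even nonroot vertices of increasing trees

even : ℕ → Bool
even d = d % 2 ≡ᵇ 0

even-suc : ∀ d → even (suc d) ≡ not (even d)
even-suc zero          = refl
even-suc (suc zero)    = refl
even-suc (suc (suc d)) = even-suc d

even-+1 : ∀ d → even (d + 1) ≡ not (even d)
even-+1 d = trans (cong even (+-comm d 1)) (even-suc d)

⌈suc/2⌉ : ∀ j → ⌈ suc j /2⌉ ≡ ⌈ j /2⌉ + 𝟙 (even j)
⌈suc/2⌉ zero          = refl
⌈suc/2⌉ (suc zero)    = refl
⌈suc/2⌉ (suc (suc j)) = cong suc (⌈suc/2⌉ j)

⌈[j+b+b]/2⌉ : ∀ j b → ⌈ j + 𝟙 b + 𝟙 b /2⌉ ≡ ⌈ j /2⌉ + 𝟙 b
⌈[j+b+b]/2⌉ j false = trans (cong ⌈_/2⌉ (trans (+-identityʳ (j + 0)) (+-identityʳ j))) (sym (+-identityʳ ⌈ j /2⌉))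
⌈[j+b+b]/2⌉ j true  = trans (cong ⌈_/2⌉ (j+1+1 j)) (+-comm 1 ⌈ j /2⌉)
  where
  j+1+1 : ∀ j → j + 1 + 1 ≡ 2 + j
  j+1+1 = solve-∀

2*⌈j/2⌉ : ∀ j → 𝟙 (not (even j)) + j ≡ 2 * ⌈ j /2⌉
2*⌈j/2⌉ zero          = refl
2*⌈j/2⌉ (suc zero)    = refl
2*⌈j/2⌉ (suc (suc j)) = begin
  𝟙 (not (even j)) + suc (suc j) ≡⟨ +-suc _ (suc j) ⟩
  suc (𝟙 (not (even j)) + suc j) ≡⟨ cong suc (+-suc _ j) ⟩
  2 + (𝟙 (not (even j)) + j)     ≡⟨ cong (2 +_) (2*⌈j/2⌉ j) ⟩
  2 + 2 * ⌈ j /2⌉                ≡⟨ *-suc 2 ⌈ j /2⌉ ⟨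
  2 * suc ⌈ j /2⌉                ∎

⌊n/2⌋≡n/2 : ∀ n → ⌊ n /2⌋ ≡ n / 2
⌊n/2⌋≡n/2 zero          = refl
⌊n/2⌋≡n/2 (suc zero)    = refl
⌊n/2⌋≡n/2 (suc (suc n)) = trans (cong suc (⌊n/2⌋≡n/2 n)) (sym (m/n≡1+[m∸n]/n {2 + n} {2} (s≤s (s≤s z≤n))))

⌈n/2⌉≡[n+1]/2 : ∀ n → ⌈ n /2⌉ ≡ (n + 1) / 2
⌈n/2⌉≡[n+1]/2 n = trans (⌊n/2⌋≡n/2 (suc n)) (cong (_/ 2) (+-comm 1 n))

count-applyUpTo : ∀ (P : ℕ → Bool) f n → count P (applyUpTo f n) ≡ ∑[ v < n ] 𝟙 (P (f v))
count-applyUpTo P f zero    = refl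
count-applyUpTo P f (suc n) = cong (𝟙 (P (f 0)) +_) (count-applyUpTo P (f ∘ suc) n)

evenNonroot-∑ : ∀ {n} (t : IncTree n) → evenNonroot t ≡ ∑[ v < n ] 𝟙 (even (deg t (suc v)))
evenNonroot-∑ {n} t = count-applyUpTo (λ v → even (deg t v)) suc n

deg-≥ : ∀ {n} (t : IncTree n) {v} → n ≤ v → deg t v ≡ 0
deg-≥ root    _   = refl
deg-≥ (t ▷ p) n<v = cong₂ _+_ (deg-≥ t (<⇒≤ n<v)) (cong 𝟙 (≢⇒≡ᵇ≡false (<⇒≢ (<-≤-trans (toℕ<n p) n<v))))

evenNonroot-▷ : ∀ {n} (t : IncTree n) p →
  evenNonroot (t ▷ p) ≡ ∑[ v < n ] 𝟙 (even (deg t (suc v) + 𝟙 (toℕ p ≡ᵇ suc v))) + 1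
evenNonroot-▷ {n} t p = begin
  evenNonroot (t ▷ p)        ≡⟨ evenNonroot-∑ (t ▷ p) ⟩
  ∑< (suc n) f               ≡⟨ ∑-init-last n f ⟩
  ∑< n f + f n               ≡⟨ cong (∑< n f +_) new-leaf ⟩
  ∑< n f + 1                 ∎
  where
  f : ℕ → ℕ
  f v = 𝟙 (even (deg (t ▷ p) (suc v)))
  new-leaf : f n ≡ 1
  new-leaf = cong (𝟙 ∘ even) (deg-≥ (t ▷ p) ≤-refl)

evenNonroot-▷-root : ∀ {n} (t : IncTree n) → evenNonroot (t ▷ zero) ≡ evenNonroot t + 1
evenNonroot-▷-root {n} t = begin
  evenNonroot (t ▷ zero)                                 ≡⟨ evenNonroot-▷ t zero ⟩
  ∑[ v < n ] 𝟙 (even (deg t (suc v) + 0)) + 1           ≡⟨ cong (_+ 1) (∑-cong n λ v → cong (𝟙 ∘ even) (+-identityʳ (deg t (suc v)))) ⟩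
  ∑[ v < n ] 𝟙 (even (deg t (suc v))) + 1               ≡⟨ cong (_+ 1) (evenNonroot-∑ t) ⟨
  evenNonroot t + 1                                      ∎

evenNonroot-▷-nonroot : ∀ {n} (t : IncTree n) q →
  evenNonroot (t ▷ suc q) + 𝟙 (even (deg t (suc (toℕ q)))) ≡ evenNonroot t + 𝟙 (not (even (deg t (suc (toℕ q))))) + 1
evenNonroot-▷-nonroot {n} t q = begin
  evenNonroot (t ▷ suc q) + g (toℕ q) ≡⟨ cong (_+ g (toℕ q)) (evenNonroot-▷ t (suc q)) ⟩
  ∑< n f + 1 + g (toℕ q)              ≡⟨ swap-last (∑< n f) 1 (g (toℕ q)) ⟩
  ∑< n f + g (toℕ q) + 1              ≡⟨ cong (_+ 1) (∑-update n f g (toℕ q) (toℕ<n q) f≗g) ⟩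
  ∑< n g + f (toℕ q) + 1              ≡⟨ cong₂ (λ x y → x + y + 1) (sym (evenNonroot-∑ t)) f[q] ⟩
  evenNonroot t + 𝟙 (not (even (deg t (suc (toℕ q))))) + 1 ∎
  where
  f g : ℕ → ℕ
  f v = 𝟙 (even (deg t (suc v) + 𝟙 (toℕ q ≡ᵇ v)))
  g v = 𝟙 (even (deg t (suc v)))
  f≗g : ∀ v → v ≢ toℕ q → f v ≡ g v
  f≗g v v≢q = trans (cong (λ b → 𝟙 (even (deg t (suc v) + 𝟙 b))) (≢⇒≡ᵇ≡false (v≢q ∘ sym)))
                    (cong (𝟙 ∘ even) (+-identityʳ (deg t (suc v))))
  f[q] : f (toℕ q) ≡ 𝟙 (not (even (deg t (suc (toℕ q)))))
  f[q] = trans (cong (λ b → 𝟙 (even (deg t (suc (toℕ q)) + 𝟙 b))) (≡ᵇ-refl (toℕ q))) (cong 𝟙 (even-+1 (deg t (suc (toℕ q)))))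
  swap-last : ∀ x y z → x + y + z ≡ x + z + y
  swap-last = solve-∀

-- Whether hanging a new leaf from v leaves ⌈ evenNonroot t /2⌉ unchanged: the
-- leaf is itself even, and a nonroot parent changes parity.
neutral : ∀ {n} → IncTree n → ℕ → Bool
neutral t zero    = not (even (evenNonroot t))
neutral t (suc v) = even (deg t (suc v))

⌈evenNonroot/2⌉-▷ : ∀ {n} (t : IncTree n) p →
  ⌈ evenNonroot (t ▷ p) /2⌉ ≡ ⌈ evenNonroot t /2⌉ + 𝟙 (not (neutral t (toℕ p)))
⌈evenNonroot/2⌉-▷ t zero = begin
  ⌈ evenNonroot (t ▷ zero) /2⌉   ≡⟨ cong ⌈_/2⌉ (trans (evenNonroot-▷-root t) (+-comm J 1)) ⟩
  ⌈ suc J /2⌉                    ≡⟨ ⌈suc/2⌉ J ⟩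
  ⌈ J /2⌉ + 𝟙 (even J)           ≡⟨ cong (λ b → ⌈ J /2⌉ + 𝟙 b) (not-involutive (even J)) ⟨
  ⌈ J /2⌉ + 𝟙 (not (not (even J))) ∎
  where J = evenNonroot t
⌈evenNonroot/2⌉-▷ t (suc q) = begin
  ⌈ evenNonroot (t ▷ suc q) /2⌉       ≡⟨ cong ⌈_/2⌉ (+𝟙-cancel e (evenNonroot-▷-nonroot t q)) ⟩
  ⌈ J + 𝟙 (not e) + 𝟙 (not e) /2⌉     ≡⟨ ⌈[j+b+b]/2⌉ J (not e) ⟩
  ⌈ J /2⌉ + 𝟙 (not e)                 ∎
  where
  J = evenNonroot t
  e = even (deg t (suc (toℕ q)))

∑-neutral : ∀ {n} (t : IncTree n) → ∑[ v < suc n ] 𝟙 (neutral t v) ≡ 2 * ⌈ evenNonroot t /2⌉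
∑-neutral t = trans (cong (𝟙 (not (even (evenNonroot t))) +_) (sym (evenNonroot-∑ t))) (2*⌈j/2⌉ (evenNonroot t))

slotMatching : ∀ {n} → IncTree n → IncTree n → Permutation′ (suc n)
slotMatching {n} c t = matching (suc n) (nearPeak (perm c)) (neutral t)

-- toTree takes the insertion code of a permutation to a tree: the gap where
-- the value k is inserted is traded for the parent of k, near-peak gaps for
-- neutral vertices.
toTree : ∀ {n} → IncTree n → IncTree n
toTree root    = root
toTree (c ▷ i) = toTree c ▷ (slotMatching c (toTree c) ⟨$⟩ʳ i)

fromTree : ∀ {n} → IncTree n → IncTree n
fromTree root    = root
fromTree (t ▷ p) = fromTree t ▷ (slotMatching (fromTree t) t ⟨$⟩ˡ p)

toTree-fromTree : ∀ {n} (t : IncTree n) → toTree (fromTree t) ≡ t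
toTree-fromTree root = refl
toTree-fromTree (t ▷ p) rewrite toTree-fromTree t = cong (t ▷_) (inverseʳ (slotMatching (fromTree t) t))

fromTree-toTree : ∀ {n} (c : IncTree n) → fromTree (toTree c) ≡ c
fromTree-toTree root = refl
fromTree-toTree (c ▷ i) rewrite fromTree-toTree c = cong (c ▷_) (inverseˡ (slotMatching c (toTree c)))

toTree-injective : ∀ {n} {c d : IncTree n} → toTree c ≡ toTree d → c ≡ d
toTree-injective {c = c} {d} eq = trans (sym (fromTree-toTree c)) (trans (cong fromTree eq) (fromTree-toTree d))

extPeaks-perm : ∀ {n} (c : IncTree n) → extPeaks (perm c) ≡ ⌈ evenNonroot (toTree c) /2⌉
extPeaks-perm root            = refl
extPeaks-perm {suc n} (c ▷ i) = begin
  extPeaks (insertMax i (perm c))                           ≡⟨ extPeaks-insertMax i (perm c) ⟩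
  extPeaks (perm c) + 𝟙 (not (nearPeak (perm c) (toℕ i)))  ≡⟨ cong₂ (λ k b → k + 𝟙 (not b)) (extPeaks-perm c)
                                                                 (matching-spec (suc n) (nearPeak (perm c)) (neutral t) equal-counts i) ⟩
  ⌈ evenNonroot t /2⌉ + 𝟙 (not (neutral t (toℕ p)))        ≡⟨ ⌈evenNonroot/2⌉-▷ t p ⟨
  ⌈ evenNonroot (t ▷ p) /2⌉                                 ∎
  where
  t = toTree c
  p = slotMatching c t ⟨$⟩ʳ i
  equal-counts : ∑[ g < suc n ] 𝟙 (nearPeak (perm c) g) ≡ ∑[ v < suc n ] 𝟙 (neutral t v)
  equal-counts = trans (∑-nearPeak (perm c)) (trans (cong (2 *_) (extPeaks-perm c)) (sym (∑-neutral t)))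

-- The construction needs no lower bound on n.
theorem5p3 : (n : ℕ) → 1 ≤ n →
    Σ (Permutation′ n → IncTree n) λ Φ →
    ((σ τ : Permutation′ n) → σ ≈ τ → Φ σ ≡ Φ τ) ×
    ((σ τ : Permutation′ n) → Φ σ ≡ Φ τ → σ ≈ τ) ×
    ((T : IncTree n) → ∃ λ σ → Φ σ ≡ T) ×
    ((σ : Permutation′ n) → extPeaks σ ≡ (evenNonroot (Φ σ) + 1) / 2)
theorem5p3 n _ =
    toTree ∘ code
  , (λ σ τ σ≈τ → cong toTree (code-cong σ≈τ))
  , (λ σ τ Φσ≡Φτ → code-injective (toTree-injective Φσ≡Φτ))
  , (λ T → perm (fromTree T) , trans (cong toTree (code-perm (fromTree T))) (toTree-fromTree T))
  , λ σ → begin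
      extPeaks σ                            ≡⟨ extPeaks-cong {σ = perm (code σ)} {σ} (perm-code σ) ⟨
      extPeaks (perm (code σ))              ≡⟨ extPeaks-perm (code σ) ⟩
      ⌈ evenNonroot (toTree (code σ)) /2⌉   ≡⟨ ⌈n/2⌉≡[n+1]/2 _ ⟩
      (evenNonroot (toTree (code σ)) + 1) / 2 ∎
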